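{- Let $p,q$ be primes with $2<p<q$. If $(x_0,y_0,z_0,w_0)$ and $(x,y,z,w)$ are quadruples of integers with $f(x_0,y_0,z_0,w_0)=f(x,y,z,w)$, then there exists an integer $l$ such that $$x_0p+(y_0+w_0)p'-lq'=xp+(y+w)p'\quad\text{and}\quad z_0p+w_0+lq=zp+w.$$
   Context: Let $p,q$ be primes with $2<p<q$, and put $p'=(p-1)/2$, $q'=(q-1)/2$. Set $d_0=pq$, $d_1=p'q$, $d_2=pq'$, $d_3=(pq-1)/2$, and for integers $x,y,z,w$ put $f(x,y,z,w)=xd_0+yd_1+zd_2+wd_3$. -}

module Defs where

open import Data.Nat using (ℕ; _∸_; _/_)
import Data.Nat as ℕ
open import Data.Integer using (ℤ; +_; _+_; _*_)

-- p' = (p-1)/2 ; for odd p the natural-number floor division is exact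
half-pred : ℕ → ℕ
half-pred n = (n ∸ 1) / 2

d₀ d₁ d₂ d₃ : ℕ → ℕ → ℤ
d₀ p q = + (p ℕ.* q)
d₁ p q = + (half-pred p ℕ.* q)
d₂ p q = + (p ℕ.* half-pred q)
d₃ p q = + half-pred (p ℕ.* q)

f : ℕ → ℕ → ℤ → ℤ → ℤ → ℤ → ℤ
f p q x y z w = x * d₀ p q + y * d₁ p q + z * d₂ p q + w * d₃ p q

-- Write p = 1 + 2p′ and q = 1 + 2q′. Then (pq - 1)/2 = p′q + q′, so
-- f(x,y,z,w) = q A + q′ B with A = xp + (y+w)p′ and B = zp + w.
-- Since q·1 + q′·(-2) = 1, two solutions of q A + q′ B = c differ by
-- (A, B) ↦ (A - l q′, B + l q) for some integer l.
module Submission where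

open import Defs
open import Data.Nat using (ℕ; suc; _<_; _%_; s≤s)
import Data.Nat as ℕ
import Data.Nat.Properties as ℕ
open import Data.Nat.DivMod using (m≡m%n+[m/n]*n; m%n<n; m*n/n≡m)
open import Data.Nat.Divisibility using (divides)
open import Data.Nat.Primality using (Prime; prime⇒irreducible)
import Data.Nat.Tactic.RingSolver as ℕ-Solver
open import Data.Integer using (ℤ; +_; _+_; _-_; _*_; -_)
import Data.Integer.Properties as ℤ
open import Data.Integer.Tactic.RingSolver using (solve-∀; solve)
open import Data.Product using (∃; _×_; _,_)
open import Data.List using (_∷_; [])
open import Data.Sum using (inj₂)
open import Relation.Binary.PropositionalEquality
open import Relation.Nullary using (contradiction)
open ≡-Reasoning

Odd : ℕ → Set
Odd n = n ≡ 1 ℕ.+ 2 ℕ.* half-pred n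

half-pred-1+2* : ∀ k → half-pred (1 ℕ.+ 2 ℕ.* k) ≡ k
half-pred-1+2* k = trans (cong (ℕ._/ 2) (ℕ.*-comm 2 k)) (m*n/n≡m k 2)

prime>2⇒odd : ∀ {p} → Prime p → 2 < p → Odd p
prime>2⇒odd {p} pp 2<p with p % 2 | m≡m%n+[m/n]*n p 2 | m%n<n p 2
... | 0 | p≡k*2 | _ with prime⇒irreducible pp (divides (p ℕ./ 2) p≡k*2)
...   | inj₂ 2≡p = contradiction 2≡p (ℕ.<⇒≢ 2<p)
prime>2⇒odd {p} pp 2<p | 1 | p≡1+k*2 | _ = begin
  p                                 ≡⟨ p≡1+2k ⟩
  1 ℕ.+ 2 ℕ.* k                     ≡⟨ cong (λ t → 1 ℕ.+ 2 ℕ.* t) (half-pred-1+2* k) ⟨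
  1 ℕ.+ 2 ℕ.* half-pred (1 ℕ.+ 2 ℕ.* k) ≡⟨ cong (λ t → 1 ℕ.+ 2 ℕ.* half-pred t) p≡1+2k ⟨
  1 ℕ.+ 2 ℕ.* half-pred p           ∎
  where
  k = p ℕ./ 2
  p≡1+2k : p ≡ 1 ℕ.+ 2 ℕ.* k
  p≡1+2k = trans p≡1+k*2 (cong suc (ℕ.*-comm k 2))
prime>2⇒odd pp 2<p | suc (suc _) | _ | s≤s (s≤s ())

half-pred-* : ∀ {p q} → Odd p → Odd q →
  half-pred (p ℕ.* q) ≡ half-pred p ℕ.* q ℕ.+ half-pred q
half-pred-* {p} {q} p-odd q-odd = begin
  half-pred (p ℕ.* q)                              ≡⟨ cong half-pred (cong₂ ℕ._*_ p-odd q-odd) ⟩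
  half-pred ((1 ℕ.+ 2 ℕ.* P) ℕ.* (1 ℕ.+ 2 ℕ.* Q))  ≡⟨ cong half-pred (odd-* P Q) ⟩
  half-pred (1 ℕ.+ 2 ℕ.* (P ℕ.* (1 ℕ.+ 2 ℕ.* Q) ℕ.+ Q)) ≡⟨ half-pred-1+2* _ ⟩
  P ℕ.* (1 ℕ.+ 2 ℕ.* Q) ℕ.+ Q                      ≡⟨ cong (λ t → P ℕ.* t ℕ.+ Q) q-odd ⟨
  P ℕ.* q ℕ.+ Q                                    ∎
  where
  P = half-pred p
  Q = half-pred q
  odd-* : ∀ P Q → (1 ℕ.+ 2 ℕ.* P) ℕ.* (1 ℕ.+ 2 ℕ.* Q) ≡ 1 ℕ.+ 2 ℕ.* (P ℕ.* (1 ℕ.+ 2 ℕ.* Q) ℕ.+ Q)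
  odd-* = ℕ-Solver.solve-∀

f≡q*A+q′*B : ∀ {p q} → Odd p → Odd q →
  ∀ x y z w → f p q x y z w ≡
    + q * (x * + p + (y + w) * + half-pred p) + + half-pred q * (z * + p + w)
f≡q*A+q′*B {p} {q} p-odd q-odd x y z w = begin
  f p q x y z w
    ≡⟨ cong (λ t → x * + (p ℕ.* q) + y * + (P ℕ.* q) + z * + (p ℕ.* Q) + w * + t)
            (half-pred-* p-odd q-odd) ⟩
  x * + (p ℕ.* q) + y * + (P ℕ.* q) + z * + (p ℕ.* Q) + w * + (P ℕ.* q ℕ.+ Q)
    ≡⟨ cong₂ (λ s t → x * s + y * t + z * + (p ℕ.* Q) + w * (t + + Q))
             (ℤ.pos-* p q) (ℤ.pos-* P q) ⟩
  x * (+ p * + q) + y * (+ P * + q) + z * + (p ℕ.* Q) + w * (+ P * + q + + Q)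
    ≡⟨ cong (λ t → x * (+ p * + q) + y * (+ P * + q) + z * t + w * (+ P * + q + + Q))
            (ℤ.pos-* p Q) ⟩
  x * (+ p * + q) + y * (+ P * + q) + z * (+ p * + Q) + w * (+ P * + q + + Q)
    ≡⟨ regroup (+ p) (+ q) (+ P) (+ Q) x y z w ⟩
  + q * (x * + p + (y + w) * + P) + + Q * (z * + p + w)
    ∎
  where
  P = half-pred p
  Q = half-pred q
  regroup : ∀ p q P Q x y z w →
    x * (p * q) + y * (P * q) + z * (p * Q) + w * (P * q + Q)
      ≡ q * (x * p + (y + w) * P) + Q * (z * p + w)
  regroup = solve-∀

proportion⇒common-factor : ∀ {a b u v D E : ℤ} → a * u + b * v ≡ + 1 →
  a * D ≡ b * E → ∃ λ l → l * b ≡ D × l * a ≡ E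
proportion⇒common-factor {a} {b} {u} {v} {D} {E} bezout aD≡bE =
  E * u + D * v , lb≡D , la≡E
  where
  lb≡D : (E * u + D * v) * b ≡ D
  lb≡D = begin
    (E * u + D * v) * b       ≡⟨ solve (b ∷ u ∷ v ∷ D ∷ E ∷ []) ⟩
    u * (b * E) + v * b * D   ≡⟨ cong (λ r → u * r + v * b * D) aD≡bE ⟨
    u * (a * D) + v * b * D   ≡⟨ solve (a ∷ b ∷ u ∷ v ∷ D ∷ []) ⟩
    (a * u + b * v) * D       ≡⟨ cong (_* D) bezout ⟩
    + 1 * D                   ≡⟨ ℤ.*-identityˡ D ⟩
    D                         ∎
  la≡E : (E * u + D * v) * a ≡ E
  la≡E = begin
    (E * u + D * v) * a       ≡⟨ solve (a ∷ u ∷ v ∷ D ∷ E ∷ []) ⟩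
    u * a * E + v * (a * D)   ≡⟨ cong (λ r → u * a * E + v * r) aD≡bE ⟩
    u * a * E + v * (b * E)   ≡⟨ solve (a ∷ b ∷ u ∷ v ∷ E ∷ []) ⟩
    (a * u + b * v) * E       ≡⟨ cong (_* E) bezout ⟩
    + 1 * E                   ≡⟨ ℤ.*-identityˡ E ⟩
    E                         ∎

solutions-differ-by-multiple : ∀ {a b u v s t s′ t′ : ℤ} → a * u + b * v ≡ + 1 →
  a * s + b * t ≡ a * s′ + b * t′ → ∃ λ l → s - l * b ≡ s′ × t + l * a ≡ t′
solutions-differ-by-multiple {a} {b} {u} {v} {s} {t} {s′} {t′} bezout same
  with proportion⇒common-factor {D = s - s′} {E = t′ - t} bezout proportional
  where
  proportional : a * (s - s′) ≡ b * (t′ - t)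
  proportional = begin
    a * (s - s′)                         ≡⟨ solve (a ∷ b ∷ s ∷ t ∷ s′ ∷ []) ⟩
    (a * s + b * t) - (a * s′ + b * t)   ≡⟨ cong (_- (a * s′ + b * t)) same ⟩
    (a * s′ + b * t′) - (a * s′ + b * t) ≡⟨ solve (a ∷ b ∷ t ∷ s′ ∷ t′ ∷ []) ⟩
    b * (t′ - t)                         ∎
... | l , lb≡s-s′ , la≡t′-t =
  l , trans (cong (λ r → s - r) lb≡s-s′) (solve (s ∷ s′ ∷ []))
    , trans (cong (λ r → t + r) la≡t′-t) (solve (t ∷ t′ ∷ []))

odd-bezout : ∀ {n k} → n ≡ 1 ℕ.+ 2 ℕ.* k → + n * + 1 + + k * - + 2 ≡ + 1
odd-bezout {k = k} refl = begin
  + (1 ℕ.+ 2 ℕ.* k) * + 1 + + k * - + 2    ≡⟨ cong (λ r → r * + 1 + + k * - + 2) (ℤ.pos-+ 1 (2 ℕ.* k)) ⟩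
  (+ 1 + + (2 ℕ.* k)) * + 1 + + k * - + 2  ≡⟨ cong (λ r → (+ 1 + r) * + 1 + + k * - + 2) (ℤ.pos-* 2 k) ⟩
  (+ 1 + + 2 * + k) * + 1 + + k * - + 2    ≡⟨ one-minus-two (+ k) ⟩
  + 1                                      ∎
  where
  one-minus-two : ∀ k → (+ 1 + + 2 * k) * + 1 + k * - + 2 ≡ + 1
  one-minus-two = solve-∀

proposition5p3 : (p q : ℕ) → Prime p → Prime q → 2 < p → p < q →
    (x₀ y₀ z₀ w₀ x y z w : ℤ) →
    f p q x₀ y₀ z₀ w₀ ≡ f p q x y z w →
    ∃ λ (l : ℤ) →
      (x₀ * + p + (y₀ + w₀) * + half-pred p - l * + half-pred q
        ≡ x * + p + (y + w) * + half-pred p)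
      × (z₀ * + p + w₀ + l * + q ≡ z * + p + w)
proposition5p3 p q p-prime q-prime 2<p p<q x₀ y₀ z₀ w₀ x y z w same-f =
  solutions-differ-by-multiple {+ q} {+ Q} {+ 1} { - + 2 } {A x₀ y₀ w₀} {B z₀ w₀} {A x y w} {B z w}
    (odd-bezout {k = Q} q-odd)
    (trans (sym (decompose x₀ y₀ z₀ w₀)) (trans same-f (decompose x y z w)))
  where
  Q = half-pred q
  A : ℤ → ℤ → ℤ → ℤ
  A x y w = x * + p + (y + w) * + half-pred p
  B : ℤ → ℤ → ℤ
  B z w = z * + p + w
  q-odd : Odd q
  q-odd = prime>2⇒odd q-prime (ℕ.<-trans 2<p p<q)
  decompose : ∀ x y z w → f p q x y z w ≡ + q * A x y w + + Q * B z w
  decompose = f≡q*A+q′*B (prime>2⇒odd p-prime 2<p) q-odd
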